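{- For every nonempty set $S\subseteq\mathbb{N}_0$, there exists a poset $P$ with $P^*=S$ if and only if there are infinitely many pairwise non-isomorphic posets $P$ with $P^*=S$.
   Context: Poset game on a (finite) poset $P$: a move chooses $p\in P$ and replaces $P$ by $P-p_\leq:=P\setminus\{p' : p\leq p'\}$. Nimber: $\mathcal{G}(\emptyset)=0$, $\mathcal{G}(P)=\mathrm{mex}(P^*)$, where $P^*=\{\mathcal{G}(P-p_\leq):p\in P\}$ is the option value set of $P$ and mex is the least nonnegative integer not in the set. $\mathbb{N}_0$ denotes the nonnegative integers. -}

module Defs where

open import Data.Nat using (ℕ; zero; suc; _≡ᵇ_)
open import Data.Bool using (Bool; true; false; T; _∧_; not; if_then_else_)
open import Data.Fin using (Fin)
open import Data.List using (List; []; _∷_; concatMap; length; allFin)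
open import Data.Bool.ListAction using (any)
open import Data.List.Membership.Propositional using (_∈_)
open import Data.Product using (Σ; _×_)
open import Relation.Binary.PropositionalEquality using (_≡_)
open import Function.Bundles using (_↔_; Inverse)

record FinPoset : Set where
  field
    size    : ℕ
    le      : Fin size → Fin size → Bool
    le-refl : ∀ x → T (le x x)
    le-antisym : ∀ x y → T (le x y) → T (le y x) → x ≡ y
    le-trans : ∀ x y z → T (le x y) → T (le y z) → T (le x z)
open FinPoset public

Iso : FinPoset → FinPoset → Set
Iso P Q = Σ (Fin (size P) ↔ Fin (size Q)) λ f →
  ∀ x y → le P x y ≡ le Q (Inverse.to f x) (Inverse.to f y)

-- mex of a finite list: least m not in the list (it is ≤ length of the list).
mexAux : List ℕ → ℕ → ℕ → ℕ
mexAux l k zero = k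
mexAux l k (suc f) = if any (λ x → x ≡ᵇ k) l then mexAux l (suc k) f else k

mex : List ℕ → ℕ
mex l = mexAux l 0 (suc (length l))

-- Subposets are subsets A : Fin n → Bool of the carrier (with induced order).
-- Removing the up-set p_≤ of p:
removeUp : (P : FinPoset) → Fin (size P) → (Fin (size P) → Bool) → (Fin (size P) → Bool)
removeUp P p A x = A x ∧ not (le P p x)

-- Nimber of the subposet A, computed with fuel; correct whenever the fuel is
-- at least the number of elements of A (each move removes at least one element).
nimber : (P : FinPoset) → ℕ → (Fin (size P) → Bool) → ℕ
nimber P zero A = 0
nimber P (suc k) A =
  mex (concatMap (λ p → if A p then nimber P k (removeUp P p A) ∷ [] else []) (allFin (size P)))

optionValues : FinPoset → List ℕ
optionValues P =
  concatMap (λ p → nimber P (size P) (removeUp P p (λ _ → true)) ∷ []) (allFin (size P))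

HasOptionSet : FinPoset → (ℕ → Set) → Set
HasOptionSet P S = ∀ m → (m ∈ optionValues P → S m) × (S m → m ∈ optionValues P)

-- If P* = S, then the disjoint union P ⊔ P ⊔ P also has option value set S. Its options
-- are P' ⊔ P ⊔ P for the options P' of P (up to the order of the copies), and these have
-- nimber G(P'): the second player cancels the two intact copies by mirroring moves between
-- them. Iterating gives posets of strictly increasing sizes with option value set S, since
-- P is nonempty when S is.

module Submission where

open import Defs
open import Data.Nat using (ℕ; zero; suc; _+_; _<_; _≤_; _≰_; z≤n; s≤s; _≡ᵇ_; >-nonZero⁻¹)
open import Data.Nat.Properties
  using ( <-cmp; ≤-refl; ≤-trans; <-trans; <-≤-trans; +-monoˡ-<; +-monoʳ-<; +-mono-<
        ; ≤-pred; <⇒≤; <⇒≢; <⇒≱; ≤∧≢⇒<; m≤n⇒m≤1+n; m≤n⇒m<n∨m≡n; n≤1+n; n≤0⇒n≡0; n≮0; n≮n; m<m+n; m≤m+n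
        ; +-identityʳ; +-suc; _≟_; ≡ᵇ⇒≡; ≡⇒≡ᵇ; module ≤-Reasoning )
open import Data.Bool using (Bool; true; false; T; _∧_; not; if_then_else_)
open import Data.Bool.Properties using (∧-zeroʳ; ∧-identityʳ; T-≡)
open import Data.Bool.ListAction using (any)
open import Data.Fin using (Fin; _↑ˡ_; _↑ʳ_; splitAt)
import Data.Fin as Fin
open import Data.Fin.Properties using (splitAt-↑ˡ; splitAt-↑ʳ; splitAt⁻¹-↑ˡ; splitAt⁻¹-↑ʳ; nonZeroIndex)
open import Data.Fin.Permutation using (↔⇒≡)
open import Data.Fin.Subset using (Subset; _∈_; _─_; ∣_∣; ⊤; ⊥; inside)
open import Data.Fin.Subset.Properties using (x∈p∩q⁺; p∩q≢∅⇒∣p─q∣<∣p∣; ∣p∣≤n; ∈⊤; p─⊥≡p)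
open import Data.Vec using ([]; _∷_; _++_; lookup; tabulate; here; there)
open import Data.Vec.Properties
  using ( lookup∘tabulate; lookup-replicate; []=⇒lookup; lookup⇒[]=
        ; tabulate-cong; tabulate∘lookup; zipWith-++ )
open import Data.List using (List; []; _∷_; length; concatMap; allFin)
open import Data.List.Properties using (length-removeAt′; concatMap-cong)
import Data.List.Membership.Propositional as List
open import Data.List.Membership.Propositional.Properties using (∈-concatMap⁺; ∈-concatMap⁻; ∈-allFin)
open import Data.List.Relation.Unary.Any as Any using (here; there)
open import Data.List.Relation.Unary.Any.Properties using (any⁺; any⁻)
open import Data.Product using (Σ; ∃; _×_; _,_; proj₁; proj₂)
open import Data.Sum using (_⊎_; inj₁; inj₂)
open import Data.Empty using (⊥-elim)
open import Function using (_∘_)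
open import Function.Bundles using (Equivalence; _⇔_; mk⇔)
open import Function.Properties.Equivalence using () renaming (trans to ⇔-trans; sym to ⇔-sym)
open import Relation.Binary using (tri<; tri≈; tri>)
open import Relation.Binary.PropositionalEquality
open import Relation.Nullary using (¬_; yes; no; contradiction)

-- Impartial games and Grundy labellings

record Game : Set₁ where
  field
    Pos  : Set
    Move : Pos → Pos → Set
    rank : Pos → ℕ
    rank-< : ∀ {x y} → Move x y → rank y < rank x
open Game public

IsGrundy : (G : Game) → (Pos G → ℕ) → Set
IsGrundy G g = ∀ x → (∀ {y} → Move G x y → g y ≢ g x)
                   × (∀ {j} → j < g x → ∃ λ y → Move G x y × g y ≡ j)

OptionValue : (G : Game) → (Pos G → ℕ) → Pos G → ℕ → Set
OptionValue G g x m = ∃ λ y → Move G x y × g y ≡ m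

-- The second alternative of back lets a copycat answer a move by restoring a symmetry.
record Response (G H : Game) (R : Pos G → Pos H → Set) : Set where
  field
    forth : ∀ {x y x'} → R x y → Move G x x' → ∃ λ y' → Move H y y' × R x' y'
    back  : ∀ {x y y'} → R x y → Move H y y' →
            (∃ λ x' → Move G x x' × R x' y') ⊎ (∃ λ y'' → Move H y' y'' × R x y'')

module _ {G H : Game} {g : Pos G → ℕ} {h : Pos H → ℕ}
         (g-grundy : IsGrundy G g) (h-grundy : IsGrundy H h) where

  response⇒grundy-≡ : ∀ {R} → Response G H R → ∀ {x y} → R x y → g x ≡ h y
  response⇒grundy-≡ {R} reply {x} {y} = go (suc (rank G x + rank H y)) ≤-refl
    where
    open Response reply
    go : ∀ n {x y} → rank G x + rank H y < n → R x y → g x ≡ h y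
    go (suc n) {x} {y} (s≤s bound) r with <-cmp (g x) (h y)
    ... | tri≈ _ gx≡hy _ = gx≡hy
    ... | tri> _ _ hy<gx =
      let x' , x⇒x' , gx'≡hy = proj₂ (g-grundy x) hy<gx
          y' , y⇒y' , r'     = forth r x⇒x'
          gx'≡hy' = go n (≤-trans (+-mono-< (rank-< G x⇒x') (rank-< H y⇒y')) bound) r'
      in contradiction (trans (sym gx'≡hy') gx'≡hy) (proj₁ (h-grundy y) y⇒y')
    ... | tri< gx<hy _ _ with proj₂ (h-grundy y) gx<hy
    ... | y' , y⇒y' , hy'≡gx with back r y⇒y'
    ...   | inj₁ (x' , x⇒x' , r') =
      let gx'≡hy' = go n (≤-trans (+-mono-< (rank-< G x⇒x') (rank-< H y⇒y')) bound) r'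
      in contradiction (trans gx'≡hy' hy'≡gx) (proj₁ (g-grundy x) x⇒x')
    ...   | inj₂ (y'' , y'⇒y'' , r') =
      let y''<y = <-trans (rank-< H y'⇒y'') (rank-< H y⇒y')
          gx≡hy'' = go n (≤-trans (+-monoʳ-< (rank G x) y''<y) bound) r'
      in contradiction (trans (sym gx≡hy'') (sym hy'≡gx)) (proj₁ (h-grundy y') y'⇒y'')

infixr 5 _⊕_
_⊕_ : Game → Game → Game
Pos  (G ⊕ H) = Pos G × Pos H
Move (G ⊕ H) (x , y) (x' , y') = (Move G x x' × y ≡ y') ⊎ (x ≡ x' × Move H y y')
rank (G ⊕ H) (x , y) = rank G x + rank H y
rank-< (G ⊕ H) {x , y} (inj₁ (x⇒x' , refl)) = +-monoˡ-< (rank H y) (rank-< G x⇒x')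
rank-< (G ⊕ H) {x , y} (inj₂ (refl , y⇒y')) = +-monoʳ-< (rank G x) (rank-< H y⇒y')

grundy-involution-invariant : {G : Game} {g : Pos G → ℕ} → IsGrundy G g →
  (σ : Pos G → Pos G) → (∀ x → σ (σ x) ≡ x) →
  (∀ {x y} → Move G x y → Move G (σ x) (σ y)) → ∀ x → g x ≡ g (σ x)
grundy-involution-invariant {G} g-grundy σ σ∘σ σ-move x =
  response⇒grundy-≡ g-grundy g-grundy reply refl
  where
  reply : Response G G (λ x y → y ≡ σ x)
  Response.forth reply {x' = x'} refl x⇒x' = σ x' , σ-move x⇒x' , refl
  Response.back  reply {x} {y' = y'} refl σx⇒y' =
    inj₁ (σ y' , subst (λ z → Move G z (σ y')) (σ∘σ x) (σ-move σx⇒y') , sym (σ∘σ y'))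

grundy-⊕-swap₁₂ : {G H : Game} {s : Pos (G ⊕ G ⊕ H) → ℕ} → IsGrundy (G ⊕ G ⊕ H) s →
  ∀ a b c → s (a , b , c) ≡ s (b , a , c)
grundy-⊕-swap₁₂ {G} {H} {s} s-grundy a b c =
  grundy-involution-invariant {G ⊕ G ⊕ H} {s} s-grundy swap (λ _ → refl) swap-move (a , b , c)
  where
  swap : Pos (G ⊕ G ⊕ H) → Pos (G ⊕ G ⊕ H)
  swap (a , b , c) = b , a , c
  swap-move : ∀ {t u} → Move (G ⊕ G ⊕ H) t u → Move (G ⊕ G ⊕ H) (swap t) (swap u)
  swap-move (inj₁ (a⇒a' , refl))                = inj₂ (refl , inj₁ (a⇒a' , refl))
  swap-move (inj₂ (refl , inj₁ (b⇒b' , refl))) = inj₁ (b⇒b' , refl)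
  swap-move (inj₂ (refl , inj₂ (refl , c⇒c'))) = inj₂ (refl , inj₂ (refl , c⇒c'))

grundy-⊕-swap₁₃ : {G H : Game} {s : Pos (G ⊕ H ⊕ G) → ℕ} → IsGrundy (G ⊕ H ⊕ G) s →
  ∀ a b c → s (a , b , c) ≡ s (c , b , a)
grundy-⊕-swap₁₃ {G} {H} {s} s-grundy a b c =
  grundy-involution-invariant {G ⊕ H ⊕ G} {s} s-grundy swap (λ _ → refl) swap-move (a , b , c)
  where
  swap : Pos (G ⊕ H ⊕ G) → Pos (G ⊕ H ⊕ G)
  swap (a , b , c) = c , b , a
  swap-move : ∀ {t u} → Move (G ⊕ H ⊕ G) t u → Move (G ⊕ H ⊕ G) (swap t) (swap u)
  swap-move (inj₁ (a⇒a' , refl))                = inj₂ (refl , inj₂ (refl , a⇒a'))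
  swap-move (inj₂ (refl , inj₁ (b⇒b' , refl))) = inj₂ (refl , inj₁ (b⇒b' , refl))
  swap-move (inj₂ (refl , inj₂ (refl , c⇒c'))) = inj₁ (c⇒c' , refl)

-- The second player mirrors every move between the two copies of H.
grundy-⊕-twins : {G H : Game} {g : Pos G → ℕ} {s : Pos (G ⊕ H ⊕ H) → ℕ} →
  IsGrundy G g → IsGrundy (G ⊕ H ⊕ H) s → ∀ x y → s (x , y , y) ≡ g x
grundy-⊕-twins {G} {H} g-grundy s-grundy x y =
  sym (response⇒grundy-≡ g-grundy s-grundy reply (y , refl))
  where
  reply : Response G (G ⊕ H ⊕ H) (λ x t → ∃ λ y → t ≡ (x , y , y))
  Response.forth reply {x' = x'} (y , refl) x⇒x' = (x' , y , y) , inj₁ (x⇒x' , refl) , y , refl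
  Response.back reply (y , refl) (inj₁ (x⇒x' , refl)) = inj₁ (_ , x⇒x' , y , refl)
  Response.back reply (y , refl) (inj₂ (refl , inj₁ (y⇒y' , refl))) =
    inj₂ (_ , inj₂ (refl , inj₂ (refl , y⇒y')) , _ , refl)
  Response.back reply (y , refl) (inj₂ (refl , inj₂ (refl , y⇒y'))) =
    inj₂ (_ , inj₂ (refl , inj₁ (y⇒y' , refl)) , _ , refl)

record Embedding (K L : Game) : Set where
  field
    embed      : Pos L → Pos K
    embed-move : ∀ {l l'} → Move L l l' → Move K (embed l) (embed l')
    lift-move  : ∀ {l k} → Move K (embed l) k → ∃ λ l' → Move L l l' × k ≡ embed l'
open Embedding public

IsGrundy-embed : {K L : Game} (e : Embedding K L) {k : Pos K → ℕ} →
  IsGrundy K k → IsGrundy L (λ l → k (embed e l))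
IsGrundy-embed {L = L} e {k} k-grundy l =
  (λ l⇒l' → proj₁ (k-grundy (embed e l)) (embed-move e l⇒l')) , below
  where
  below : ∀ {j} → j < k (embed e l) → ∃ λ l' → Move L l l' × k (embed e l') ≡ j
  below j< with proj₂ (k-grundy (embed e l)) j<
  ... | z , el⇒z , kz≡j with lift-move e el⇒z
  ...   | l' , l⇒l' , refl = l' , l⇒l' , kz≡j

Embedding-∘ : {K L M : Game} → Embedding K L → Embedding L M → Embedding K M
embed      (Embedding-∘ e f) m = embed e (embed f m)
embed-move (Embedding-∘ e f) m⇒m' = embed-move e (embed-move f m⇒m')
lift-move  (Embedding-∘ e f) efm⇒k with lift-move e efm⇒k
... | l' , fm⇒l' , refl with lift-move f fm⇒l'
...   | m' , m⇒m' , refl = m' , m⇒m' , refl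

⊕-embedʳ : (G : Game) {K L : Game} → Embedding K L → Embedding (G ⊕ K) (G ⊕ L)
embed      (⊕-embedʳ G e) (x , l) = x , embed e l
embed-move (⊕-embedʳ G e) (inj₁ (x⇒x' , refl)) = inj₁ (x⇒x' , refl)
embed-move (⊕-embedʳ G e) (inj₂ (refl , l⇒l')) = inj₂ (refl , embed-move e l⇒l')
lift-move  (⊕-embedʳ G e) {x , l} (inj₁ (x⇒x' , refl)) = (_ , l) , inj₁ (x⇒x' , refl) , refl
lift-move  (⊕-embedʳ G e) {x , l} (inj₂ (refl , el⇒k)) with lift-move e el⇒k
... | l' , l⇒l' , refl = (x , l') , inj₂ (refl , l⇒l') , refl

∈⇒any-≡ᵇ : ∀ {k l} → k List.∈ l → T (any (_≡ᵇ k) l)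
∈⇒any-≡ᵇ {k} k∈l = any⁺ _ (Any.map (λ { refl → ≡⇒≡ᵇ k k refl }) k∈l)

any-≡ᵇ⇒∈ : ∀ {k} l → T (any (_≡ᵇ k) l) → k List.∈ l
any-≡ᵇ⇒∈ l t = Any.map (λ x≡ᵇk → sym (≡ᵇ⇒≡ _ _ x≡ᵇk)) (any⁻ _ l t)

∈-─ : ∀ {x y : ℕ} {l} (x∈l : x List.∈ l) → y List.∈ l → y ≢ x → y List.∈ (l Any.─ x∈l)
∈-─ (here refl) (here refl) y≢x = contradiction refl y≢x
∈-─ (here refl) (there y∈l) _   = y∈l
∈-─ (there x∈l) (here refl) _   = here refl
∈-─ (there x∈l) (there y∈l) y≢x = there (∈-─ x∈l y∈l y≢x)

initial-segment⊆⇒≤length : ∀ k l → (∀ {j} → j < k → j List.∈ l) → k ≤ length l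
initial-segment⊆⇒≤length zero    l _ = z≤n
initial-segment⊆⇒≤length (suc k) l ⊆l = begin
  suc k                          ≤⟨ s≤s (initial-segment⊆⇒≤length k (l Any.─ k∈l) ⊆l─k) ⟩
  suc (length (l Any.─ k∈l))     ≡⟨ length-removeAt′ l (Any.index k∈l) ⟨
  length l                       ∎
  where
  open ≤-Reasoning
  k∈l : k List.∈ l
  k∈l = ⊆l ≤-refl
  ⊆l─k : ∀ {j} → j < k → j List.∈ (l Any.─ k∈l)
  ⊆l─k j<k = ∈-─ k∈l (⊆l (m≤n⇒m≤1+n j<k)) (<⇒≢ j<k)

mexAux-below : ∀ l k fuel {j} → k ≤ j → j < mexAux l k fuel → j List.∈ l
mexAux-below l k zero    k≤j j<k = contradiction k≤j (<⇒≱ j<k)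
mexAux-below l k (suc fuel) {j} k≤j j<mex with any (_≡ᵇ k) l in found
... | false = contradiction k≤j (<⇒≱ j<mex)
... | true with k ≟ j
...   | yes refl = any-≡ᵇ⇒∈ l (subst T (sym found) _)
...   | no k≢j   = mexAux-below l (suc k) fuel (≤∧≢⇒< k≤j k≢j) j<mex

mexAux-∉ : ∀ l k fuel → mexAux l k fuel List.∉ l ⊎ mexAux l k fuel ≡ k + fuel
mexAux-∉ l k zero = inj₂ (sym (+-identityʳ k))
mexAux-∉ l k (suc fuel) with any (_≡ᵇ k) l in found
... | false = inj₁ λ k∈l → subst T found (∈⇒any-≡ᵇ k∈l)
... | true with mexAux-∉ l (suc k) fuel
...   | inj₁ ∉l = inj₁ ∉l
...   | inj₂ ≡k+fuel = inj₂ (trans ≡k+fuel (sym (+-suc k fuel)))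

mex-below : ∀ l {j} → j < mex l → j List.∈ l
mex-below l = mexAux-below l 0 (suc (length l)) z≤n

mex-∉ : ∀ l → mex l List.∉ l
mex-∉ l with mexAux-∉ l 0 (suc (length l))
... | inj₁ ∉l = ∉l
... | inj₂ ≡1+length = λ _ → contradiction (initial-segment⊆⇒≤length _ l (mex-below l))
                                          (subst (_≰ length l) (sym ≡1+length) (n≮n _))

mex-unique : ∀ l {m} → m List.∉ l → (∀ {j} → j < m → j List.∈ l) → mex l ≡ m
mex-unique l {m} m∉l below with <-cmp (mex l) m
... | tri< mex<m _ _ = contradiction (below mex<m) (mex-∉ l)
... | tri≈ _ mex≡m _ = mex≡m
... | tri> _ _ m<mex = contradiction (mex-below l m<mex) m∉l

-- The poset game

lookup-─ : ∀ {n} (u v : Subset n) x → lookup (u ─ v) x ≡ lookup u x ∧ not (lookup v x)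
lookup-─ (a ∷ u) (true  ∷ v) Fin.zero    = sym (∧-zeroʳ a)
lookup-─ (a ∷ u) (false ∷ v) Fin.zero    = sym (∧-identityʳ a)
lookup-─ (_ ∷ u) (_     ∷ v) (Fin.suc x) = lookup-─ u v x

∈⇒T-lookup : ∀ {n} {u : Subset n} {x} → x ∈ u → T (lookup u x)
∈⇒T-lookup x∈u = Equivalence.from T-≡ ([]=⇒lookup x∈u)

T-lookup⇒∈ : ∀ {n} (u : Subset n) x → T (lookup u x) → x ∈ u
T-lookup⇒∈ u x t = lookup⇒[]= x u (Equivalence.to T-≡ t)

module _ (P : FinPoset) where

  ↑ : Fin (size P) → Subset (size P)
  ↑ p = tabulate (le P p)

  p∈↑p : ∀ p → p ∈ ↑ p
  p∈↑p p = T-lookup⇒∈ (↑ p) p (subst T (sym (lookup∘tabulate (le P p) p)) (le-refl P p))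

  removeUp-lookup : ∀ p u x → removeUp P p (lookup u) x ≡ lookup (u ─ ↑ p) x
  removeUp-lookup p u x = begin
    lookup u x ∧ not (le P p x)           ≡⟨ cong (λ b → lookup u x ∧ not b) (lookup∘tabulate (le P p) x) ⟨
    lookup u x ∧ not (lookup (↑ p) x)     ≡⟨ lookup-─ u (↑ p) x ⟨
    lookup (u ─ ↑ p) x                    ∎
    where open ≡-Reasoning

  ∣─↑∣< : ∀ {p u} → p ∈ u → ∣ u ─ ↑ p ∣ < ∣ u ∣
  ∣─↑∣< {p} {u} p∈u = p∩q≢∅⇒∣p─q∣<∣p∣ u (↑ p) (p , x∈p∩q⁺ (p∈u , p∈↑p p))

  -- Positions are bit vectors rather than predicates, so that the position reached by a
  -- move is determined up to ≡ without function extensionality.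
  PosetGame : Game
  Pos    PosetGame = Subset (size P)
  Move   PosetGame u w = ∃ λ p → p ∈ u × w ≡ u ─ ↑ p
  rank   PosetGame = ∣_∣
  rank-< PosetGame (p , p∈u , refl) = ∣─↑∣< p∈u

  nim : Subset (size P) → ℕ
  nim u = nimber P (size P) (lookup u)

  option : ℕ → (Fin (size P) → Bool) → Fin (size P) → List ℕ
  option k A p = if A p then nimber P k (removeUp P p A) ∷ [] else []

  options : ℕ → (Fin (size P) → Bool) → List ℕ
  options k A = concatMap (option k A) (allFin (size P))

  ∈-options⁻ : ∀ k A {j} → j List.∈ options k A → ∃ λ p → T (A p) × nimber P k (removeUp P p A) ≡ j
  ∈-options⁻ k A j∈ with Any.satisfied (∈-concatMap⁻ (option k A) {xs = allFin (size P)} j∈)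
  ... | p , j∈option with A p in Ap≡true | j∈option
  ...   | true | here j≡m = p , subst T (sym Ap≡true) _ , sym j≡m

  nimber-cong : ∀ k {A B} → (∀ x → A x ≡ B x) → nimber P k A ≡ nimber P k B
  nimber-cong zero    A≗B = refl
  nimber-cong (suc k) {A} {B} A≗B = cong mex (concatMap-cong option-cong (allFin (size P)))
    where
    option-cong : ∀ p → option k A p ≡ option k B p
    option-cong p = cong₂ (λ b m → if b then m ∷ [] else []) (A≗B p)
                      (nimber-cong k λ x → cong (_∧ not (le P p x)) (A≗B x))

  ∈-options⁺ : ∀ k A {p} → T (A p) → nimber P k (removeUp P p A) List.∈ options k A
  ∈-options⁺ k A {p} Ap = ∈-concatMap⁺ (option k A) (Any.map (λ { refl → ∈-option }) (∈-allFin p))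
    where
    ∈-option : nimber P k (removeUp P p A) List.∈ option k A p
    ∈-option with A p
    ... | true = here refl

  nimber-removeUp : ∀ k p u → nimber P k (removeUp P p (lookup u)) ≡ nimber P k (lookup (u ─ ↑ p))
  nimber-removeUp k p u = nimber-cong k (removeUp-lookup p u)

  nimber-suc : ∀ k u → ∣ u ∣ ≤ k → nimber P (suc k) (lookup u) ≡ nimber P k (lookup u)
  nimber-suc zero u ∣u∣≤0 = mex-unique (options 0 (lookup u)) 0∉ λ ()
    where
    0∉ : 0 List.∉ options 0 (lookup u)
    0∉ 0∈ = let p , u[p] , _ = ∈-options⁻ 0 (lookup u) 0∈
            in n≮0 (<-≤-trans (∣─↑∣< (T-lookup⇒∈ u p u[p])) ∣u∣≤0)
  nimber-suc (suc k) u ∣u∣≤1+k = cong mex (concatMap-cong option-suc (allFin (size P)))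
    where
    option-suc : ∀ p → option (suc k) (lookup u) p ≡ option k (lookup u) p
    option-suc p with lookup u p in u[p]≡true
    ... | false = refl
    ... | true  = cong (_∷ []) (begin
      nimber P (suc k) (removeUp P p (lookup u))   ≡⟨ nimber-removeUp (suc k) p u ⟩
      nimber P (suc k) (lookup (u ─ ↑ p))          ≡⟨ nimber-suc k (u ─ ↑ p) ∣u─↑p∣≤k ⟩
      nimber P k (lookup (u ─ ↑ p))                ≡⟨ nimber-removeUp k p u ⟨
      nimber P k (removeUp P p (lookup u))         ∎)
      where
      open ≡-Reasoning
      ∣u─↑p∣≤k : ∣ u ─ ↑ p ∣ ≤ k
      ∣u─↑p∣≤k = ≤-pred (<-≤-trans (∣─↑∣< (lookup⇒[]= p u u[p]≡true)) ∣u∣≤1+k)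

  nimber-fuel : ∀ k u → ∣ u ∣ ≤ k → nimber P k (lookup u) ≡ nimber P ∣ u ∣ (lookup u)
  nimber-fuel zero    u ∣u∣≤0 = cong (λ k → nimber P k (lookup u)) (sym (n≤0⇒n≡0 ∣u∣≤0))
  nimber-fuel (suc k) u ∣u∣≤1+k with m≤n⇒m<n∨m≡n ∣u∣≤1+k
  ... | inj₁ (s≤s ∣u∣≤k) = trans (nimber-suc k u ∣u∣≤k) (nimber-fuel k u ∣u∣≤k)
  ... | inj₂ ∣u∣≡1+k     = cong (λ k → nimber P k (lookup u)) (sym ∣u∣≡1+k)

  nim-fuel : ∀ {k} u → ∣ u ∣ ≤ k → nimber P k (lookup u) ≡ nim u
  nim-fuel {k} u ∣u∣≤k = trans (nimber-fuel k u ∣u∣≤k) (sym (nimber-fuel (size P) u (∣p∣≤n u)))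

  nim-≡-mex : ∀ u → nim u ≡ mex (options ∣ u ∣ (lookup u))
  nim-≡-mex u = sym (nim-fuel u (n≤1+n ∣ u ∣))

  option-nim : ∀ {p u} → p ∈ u → nimber P ∣ u ∣ (removeUp P p (lookup u)) ≡ nim (u ─ ↑ p)
  option-nim {p} {u} p∈u = trans (nimber-removeUp ∣ u ∣ p u) (nim-fuel (u ─ ↑ p) (<⇒≤ (∣─↑∣< p∈u)))

  nim-grundy : IsGrundy PosetGame nim
  nim-grundy u = differs , below
    where
    opts : List ℕ
    opts = options ∣ u ∣ (lookup u)
    differs : ∀ {w} → Move PosetGame u w → nim w ≢ nim u
    differs (p , p∈u , refl) nim≡ =
      mex-∉ opts (subst (List._∈ opts) option≡mex (∈-options⁺ ∣ u ∣ (lookup u) (∈⇒T-lookup p∈u)))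
      where
      option≡mex : nimber P ∣ u ∣ (removeUp P p (lookup u)) ≡ mex opts
      option≡mex = trans (option-nim p∈u) (trans nim≡ (nim-≡-mex u))
    below : ∀ {j} → j < nim u → ∃ λ w → Move PosetGame u w × nim w ≡ j
    below j<nim with ∈-options⁻ ∣ u ∣ (lookup u) (mex-below opts (subst (_ <_) (nim-≡-mex u) j<nim))
    ... | p , u[p] , ≡j = u ─ ↑ p , (p , p∈u , refl) , trans (sym (option-nim p∈u)) ≡j
      where
      p∈u : p ∈ u
      p∈u = T-lookup⇒∈ u p u[p]

  nimber-removeUp-⊤ : ∀ p → nimber P (size P) (removeUp P p (λ _ → true)) ≡ nim (⊤ ─ ↑ p)
  nimber-removeUp-⊤ p = nimber-cong (size P) λ x →
    trans (cong (λ b → b ∧ not (le P p x)) (sym (lookup-replicate x true))) (removeUp-lookup p ⊤ x)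

  ∈-optionValues⇔ : ∀ {m} → m List.∈ optionValues P ⇔ OptionValue PosetGame nim ⊤ m
  ∈-optionValues⇔ = mk⇔ to from
    where
    value : Fin (size P) → List ℕ
    value p = nimber P (size P) (removeUp P p (λ _ → true)) ∷ []
    to : ∀ {m} → m List.∈ optionValues P → OptionValue PosetGame nim ⊤ m
    to m∈ with Any.satisfied (∈-concatMap⁻ value {xs = allFin (size P)} m∈)
    ... | p , here m≡ = ⊤ ─ ↑ p , (p , ∈⊤ , refl) , sym (trans m≡ (nimber-removeUp-⊤ p))
    from : ∀ {m} → OptionValue PosetGame nim ⊤ m → m List.∈ optionValues P
    from (_ , (p , _ , refl) , ≡m) =
      ∈-concatMap⁺ value (Any.map (λ { refl → here (sym (trans (nimber-removeUp-⊤ p) ≡m)) })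
                                  (∈-allFin p))

-- Disjoint unions of posets

⊎-le : (Q R : FinPoset) → Fin (size Q) ⊎ Fin (size R) → Fin (size Q) ⊎ Fin (size R) → Bool
⊎-le Q R (inj₁ a) (inj₁ b) = le Q a b
⊎-le Q R (inj₂ a) (inj₂ b) = le R a b
⊎-le Q R (inj₁ _) (inj₂ _) = false
⊎-le Q R (inj₂ _) (inj₁ _) = false

infixr 5 _⊎ᴾ_
_⊎ᴾ_ : FinPoset → FinPoset → FinPoset
size (Q ⊎ᴾ R) = size Q + size R
le   (Q ⊎ᴾ R) i j = ⊎-le Q R (splitAt (size Q) i) (splitAt (size Q) j)
le-refl (Q ⊎ᴾ R) i with splitAt (size Q) i
... | inj₁ a = le-refl Q a
... | inj₂ b = le-refl R b
le-antisym (Q ⊎ᴾ R) i j i≤j j≤i with splitAt (size Q) i in i≡ | splitAt (size Q) j in j≡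
... | inj₁ a | inj₁ b = trans (sym (splitAt⁻¹-↑ˡ i≡))
                          (trans (cong (_↑ˡ size R) (le-antisym Q a b i≤j j≤i)) (splitAt⁻¹-↑ˡ j≡))
... | inj₂ a | inj₂ b = trans (sym (splitAt⁻¹-↑ʳ i≡))
                          (trans (cong (size Q ↑ʳ_) (le-antisym R a b i≤j j≤i)) (splitAt⁻¹-↑ʳ j≡))
le-trans (Q ⊎ᴾ R) i j k i≤j j≤k with splitAt (size Q) i | splitAt (size Q) j | splitAt (size Q) k
... | inj₁ a | inj₁ b | inj₁ c = le-trans Q a b c i≤j j≤k
... | inj₂ a | inj₂ b | inj₂ c = le-trans R a b c i≤j j≤k
... | inj₁ _ | inj₁ _ | inj₂ _ = ⊥-elim j≤k
... | inj₂ _ | inj₂ _ | inj₁ _ = ⊥-elim j≤k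
... | inj₁ _ | inj₂ _ | _      = ⊥-elim i≤j
... | inj₂ _ | inj₁ _ | _      = ⊥-elim i≤j

data Split (n m : ℕ) : Fin (n + m) → Set where
  left  : ∀ c → Split n m (c ↑ˡ m)
  right : ∀ d → Split n m (n ↑ʳ d)

split : ∀ n m i → Split n m i
split n m i with splitAt n {m} i in i≡
... | inj₁ c = subst (Split n m) (splitAt⁻¹-↑ˡ i≡) (left c)
... | inj₂ d = subst (Split n m) (splitAt⁻¹-↑ʳ i≡) (right d)

tabulate-++ : ∀ {A : Set} n {m} (f : Fin (n + m) → A) →
  tabulate f ≡ tabulate (f ∘ (_↑ˡ m)) ++ tabulate (f ∘ (n ↑ʳ_))
tabulate-++ zero    f = refl
tabulate-++ (suc n) f = cong (f Fin.zero ∷_) (tabulate-++ n (f ∘ Fin.suc))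

tabulate-false : ∀ n → tabulate {n = n} (λ _ → false) ≡ ⊥
tabulate-false n = trans (tabulate-cong λ x → sym (lookup-replicate x false)) (tabulate∘lookup ⊥)

∈-++⁺ˡ : ∀ {n m} {a : Subset n} {b : Subset m} {p} → p ∈ a → p ↑ˡ m ∈ a ++ b
∈-++⁺ˡ here        = here
∈-++⁺ˡ (there p∈a) = there (∈-++⁺ˡ p∈a)

∈-++⁺ʳ : ∀ {n m} (a : Subset n) {b : Subset m} {p} → p ∈ b → n ↑ʳ p ∈ a ++ b
∈-++⁺ʳ []      p∈b = p∈b
∈-++⁺ʳ (_ ∷ a) p∈b = there (∈-++⁺ʳ a p∈b)

∈-++⁻ˡ : ∀ {n m} (a : Subset n) {b : Subset m} p → p ↑ˡ m ∈ a ++ b → p ∈ a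
∈-++⁻ˡ (_ ∷ a) Fin.zero    here      = here
∈-++⁻ˡ (_ ∷ a) (Fin.suc p) (there i) = there (∈-++⁻ˡ a p i)

∈-++⁻ʳ : ∀ {n m} (a : Subset n) {b : Subset m} {p} → n ↑ʳ p ∈ a ++ b → p ∈ b
∈-++⁻ʳ []      p∈b       = p∈b
∈-++⁻ʳ (_ ∷ a) (there i) = ∈-++⁻ʳ a i

module _ (Q R : FinPoset) where
  private
    n = size Q
    m = size R

  ↑-↑ˡ : ∀ p → ↑ (Q ⊎ᴾ R) (p ↑ˡ m) ≡ ↑ Q p ++ ⊥
  ↑-↑ˡ p = trans (tabulate-++ n (le (Q ⊎ᴾ R) (p ↑ˡ m)))
                 (cong₂ _++_ (tabulate-cong ≤-left) (trans (tabulate-cong ≰-right) (tabulate-false m)))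
    where
    ≤-left : ∀ c → le (Q ⊎ᴾ R) (p ↑ˡ m) (c ↑ˡ m) ≡ le Q p c
    ≤-left c rewrite splitAt-↑ˡ n p m | splitAt-↑ˡ n c m = refl
    ≰-right : ∀ d → le (Q ⊎ᴾ R) (p ↑ˡ m) (n ↑ʳ d) ≡ false
    ≰-right d rewrite splitAt-↑ˡ n p m | splitAt-↑ʳ n m d = refl

  ↑-↑ʳ : ∀ p → ↑ (Q ⊎ᴾ R) (n ↑ʳ p) ≡ ⊥ ++ ↑ R p
  ↑-↑ʳ p = trans (tabulate-++ n (le (Q ⊎ᴾ R) (n ↑ʳ p)))
                 (cong₂ _++_ (trans (tabulate-cong ≰-left) (tabulate-false n)) (tabulate-cong ≤-right))
    where
    ≰-left : ∀ c → le (Q ⊎ᴾ R) (n ↑ʳ p) (c ↑ˡ m) ≡ false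
    ≰-left c rewrite splitAt-↑ʳ n m p | splitAt-↑ˡ n c m = refl
    ≤-right : ∀ d → le (Q ⊎ᴾ R) (n ↑ʳ p) (n ↑ʳ d) ≡ le R p d
    ≤-right d rewrite splitAt-↑ʳ n m p | splitAt-↑ʳ n m d = refl

  ─-↑-↑ˡ : ∀ a b p → (a ++ b) ─ ↑ (Q ⊎ᴾ R) (p ↑ˡ m) ≡ (a ─ ↑ Q p) ++ b
  ─-↑-↑ˡ a b p = begin
    (a ++ b) ─ ↑ (Q ⊎ᴾ R) (p ↑ˡ m)   ≡⟨ cong ((a ++ b) ─_) (↑-↑ˡ p) ⟩
    (a ++ b) ─ (↑ Q p ++ ⊥)          ≡⟨ zipWith-++ _ a b (↑ Q p) ⊥ ⟩
    (a ─ ↑ Q p) ++ (b ─ ⊥)           ≡⟨ cong ((a ─ ↑ Q p) ++_) (p─⊥≡p b) ⟩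
    (a ─ ↑ Q p) ++ b                 ∎
    where open ≡-Reasoning

  ─-↑-↑ʳ : ∀ a b p → (a ++ b) ─ ↑ (Q ⊎ᴾ R) (n ↑ʳ p) ≡ a ++ (b ─ ↑ R p)
  ─-↑-↑ʳ a b p = begin
    (a ++ b) ─ ↑ (Q ⊎ᴾ R) (n ↑ʳ p)   ≡⟨ cong ((a ++ b) ─_) (↑-↑ʳ p) ⟩
    (a ++ b) ─ (⊥ ++ ↑ R p)          ≡⟨ zipWith-++ _ a b ⊥ (↑ R p) ⟩
    (a ─ ⊥) ++ (b ─ ↑ R p)           ≡⟨ cong (_++ (b ─ ↑ R p)) (p─⊥≡p a) ⟩
    a ++ (b ─ ↑ R p)                 ∎
    where open ≡-Reasoning

  PosetGame-⊎ᴾ : Embedding (PosetGame (Q ⊎ᴾ R)) (PosetGame Q ⊕ PosetGame R)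
  embed PosetGame-⊎ᴾ (a , b) = a ++ b
  embed-move PosetGame-⊎ᴾ {a , b} (inj₁ ((p , p∈a , refl) , refl)) =
    p ↑ˡ m , ∈-++⁺ˡ p∈a , sym (─-↑-↑ˡ a b p)
  embed-move PosetGame-⊎ᴾ {a , b} (inj₂ (refl , (p , p∈b , refl))) =
    n ↑ʳ p , ∈-++⁺ʳ a p∈b , sym (─-↑-↑ʳ a b p)
  lift-move PosetGame-⊎ᴾ {a , b} (p , p∈ab , refl) with split n m p
  ... | left c  = (a ─ ↑ Q c , b) , inj₁ ((c , ∈-++⁻ˡ a c p∈ab , refl) , refl) , ─-↑-↑ˡ a b c
  ... | right d = (a , b ─ ↑ R d) , inj₂ (refl , (d , ∈-++⁻ʳ a p∈ab , refl)) , ─-↑-↑ʳ a b d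

-- Three copies

triple : FinPoset → FinPoset
triple Q = Q ⊎ᴾ Q ⊎ᴾ Q

module _ (Q : FinPoset) where
  private
    G = PosetGame Q
    e : Embedding (PosetGame (triple Q)) (G ⊕ G ⊕ G)
    e = Embedding-∘ (PosetGame-⊎ᴾ Q (Q ⊎ᴾ Q)) (⊕-embedʳ G (PosetGame-⊎ᴾ Q Q))
    s : Pos (G ⊕ G ⊕ G) → ℕ
    s = nim (triple Q) ∘ embed e
    s-grundy : IsGrundy (G ⊕ G ⊕ G) s
    s-grundy = IsGrundy-embed e (nim-grundy (triple Q))
    twins : ∀ x y → s (x , y , y) ≡ nim Q x
    twins = grundy-⊕-twins {G} {G} {s = s} (nim-grundy Q) s-grundy

  OptionValue-triple : ∀ x {m} →
    OptionValue (PosetGame (triple Q)) (nim (triple Q)) (x ++ x ++ x) m ⇔ OptionValue G (nim Q) x m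
  OptionValue-triple x = mk⇔ to from
    where
    to : ∀ {m} → OptionValue (PosetGame (triple Q)) (nim (triple Q)) (x ++ x ++ x) m →
         OptionValue G (nim Q) x m
    to (_ , xxx⇒w , ≡m) with lift-move e {x , x , x} xxx⇒w
    ... | (a , .x , .x) , inj₁ (x⇒a , refl) , refl =
      a , x⇒a , trans (sym (twins a x)) ≡m
    ... | (.x , b , .x) , inj₂ (refl , inj₁ (x⇒b , refl)) , refl =
      b , x⇒b , trans (sym (twins b x)) (trans (grundy-⊕-swap₁₂ {G} {G} {s} s-grundy b x x) ≡m)
    ... | (.x , .x , c) , inj₂ (refl , inj₂ (refl , x⇒c)) , refl =
      c , x⇒c , trans (sym (twins c x)) (trans (grundy-⊕-swap₁₃ {G} {G} {s} s-grundy c x x) ≡m)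
    from : ∀ {m} → OptionValue G (nim Q) x m →
           OptionValue (PosetGame (triple Q)) (nim (triple Q)) (x ++ x ++ x) m
    from (a , x⇒a , ≡m) =
      embed e (a , x , x) , embed-move e {x , x , x} (inj₁ (x⇒a , refl)) , trans (twins a x) ≡m

⊤-++ : ∀ n {m} → ⊤ {n} ++ ⊤ {m} ≡ ⊤
⊤-++ zero    = refl
⊤-++ (suc n) = cong (inside ∷_) (⊤-++ n)

optionValues-triple : ∀ Q {m} → m List.∈ optionValues (triple Q) ⇔ m List.∈ optionValues Q
optionValues-triple Q {m} =
  ⇔-trans (∈-optionValues⇔ (triple Q)) (⇔-trans at-⊤ (⇔-sym (∈-optionValues⇔ Q)))
  where
  ⊤³≡⊤ : ⊤ {size Q} ++ ⊤ {size Q} ++ ⊤ {size Q} ≡ ⊤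
  ⊤³≡⊤ = trans (cong (⊤ {size Q} ++_) (⊤-++ (size Q) {size Q})) (⊤-++ (size Q))
  at-⊤ : OptionValue (PosetGame (triple Q)) (nim (triple Q)) ⊤ m ⇔ OptionValue (PosetGame Q) (nim Q) ⊤ m
  at-⊤ = subst (λ u → OptionValue (PosetGame (triple Q)) (nim (triple Q)) u m
                      ⇔ OptionValue (PosetGame Q) (nim Q) ⊤ m)
               ⊤³≡⊤ (OptionValue-triple Q ⊤)

HasOptionSet-⇔ : ∀ P Q {S} → (∀ {m} → m List.∈ optionValues P ⇔ m List.∈ optionValues Q) →
  HasOptionSet Q S → HasOptionSet P S
HasOptionSet-⇔ P Q P⇔Q Q*≡S m =
  proj₁ (Q*≡S m) ∘ Equivalence.to P⇔Q , Equivalence.from P⇔Q ∘ proj₂ (Q*≡S m)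

tower : FinPoset → ℕ → FinPoset
tower P zero    = P
tower P (suc i) = triple (tower P i)

HasOptionSet-tower : ∀ P {S} → HasOptionSet P S → ∀ i → HasOptionSet (tower P i) S
HasOptionSet-tower P P*≡S zero    = P*≡S
HasOptionSet-tower P P*≡S (suc i) =
  HasOptionSet-⇔ (triple (tower P i)) (tower P i) (optionValues-triple (tower P i))
    (HasOptionSet-tower P P*≡S i)

size<size-triple : ∀ Q → 0 < size Q → size Q < size (triple Q)
size<size-triple Q 0<Q = m<m+n (size Q) (<-≤-trans 0<Q (m≤m+n _ _))

0<size-tower : ∀ P → 0 < size P → ∀ i → 0 < size (tower P i)
0<size-tower P 0<P zero    = 0<P
0<size-tower P 0<P (suc i) = <-trans 0<Pᵢ (size<size-triple (tower P i) 0<Pᵢ)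
  where
  0<Pᵢ : 0 < size (tower P i)
  0<Pᵢ = 0<size-tower P 0<P i

size-tower-< : ∀ P → 0 < size P → ∀ {i j} → i < j → size (tower P i) < size (tower P j)
size-tower-< P 0<P {i} {suc j} (s≤s i≤j) with m≤n⇒m<n∨m≡n i≤j
... | inj₁ i<j  = <-trans (size-tower-< P 0<P i<j) (size<size-triple (tower P j) (0<size-tower P 0<P j))
... | inj₂ refl = size<size-triple (tower P i) (0<size-tower P 0<P i)

Iso⇒size-≡ : ∀ P Q → Iso P Q → size P ≡ size Q
Iso⇒size-≡ P Q (P↔Q , _) = ↔⇒≡ P↔Q

tower-non-iso : ∀ P → 0 < size P → ∀ i j → i ≢ j → ¬ Iso (tower P i) (tower P j)
tower-non-iso P 0<P i j i≢j iso with <-cmp i j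
... | tri< i<j _ _ = <⇒≢ (size-tower-< P 0<P i<j) (Iso⇒size-≡ (tower P i) (tower P j) iso)
... | tri≈ _ i≡j _ = i≢j i≡j
... | tri> _ _ j<i = <⇒≢ (size-tower-< P 0<P j<i) (sym (Iso⇒size-≡ (tower P i) (tower P j) iso))

optionValue⇒0<size : ∀ P {m} → m List.∈ optionValues P → 0 < size P
optionValue⇒0<size P m∈ with Equivalence.to (∈-optionValues⇔ P) m∈
... | _ , (p , _) , _ = >-nonZero⁻¹ _ {{nonZeroIndex p}}

theorem5 : (S : ℕ → Set) → ∃ S →
    ((Σ FinPoset λ P → HasOptionSet P S)
      ⇔ (Σ (ℕ → FinPoset) λ f →
           (∀ i → HasOptionSet (f i) S) × (∀ i j → i ≢ j → ¬ Iso (f i) (f j))))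
theorem5 S (m , Sm) = mk⇔
  (λ (P , P*≡S) → tower P , HasOptionSet-tower P P*≡S
                , tower-non-iso P (optionValue⇒0<size P (proj₂ (P*≡S m) Sm)))
  (λ (f , f*≡S , _) → f 0 , f*≡S 0)
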